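{- In Level Theory $\mathsf{LT}$, the following hold for all sets $a,b$ and all levels $r,s$: (1) $\mathrm{lev}(a)$ and $\mathrm{pot}(a)$ both exist, and $\mathrm{pot}(a)\subseteq\mathrm{lev}(a)$; (2) $a\notin\mathrm{lev}(a)$; (3) $r\subseteq s$ iff $s\notin r$; (4) $s=\mathrm{lev}(s)$; (5) if $b\subseteq a$ then $\mathrm{lev}(b)\subseteq\mathrm{lev}(a)$; (6) if $b\in a$ then $\mathrm{lev}(b)\in\mathrm{lev}(a)$; (7) $\mathrm{lev}(a)=\mathrm{pot}(\{\mathrm{lev}(x):x\in a\})$; (8) if every member of $a$ is a level, then $\mathrm{pot}(a)=\mathrm{lev}(a)$.
   Context: Level Theory $\mathsf{LT}$: classical second-order logic with Comprehension, sole primitive $\in$, axioms Extensionality $\forall a\forall b(\forall x(x\in a\leftrightarrow x\in b)\to a=b)$, Separation $\forall F\forall a\exists b\forall x(x\in b\leftrightarrow(F(x)\land x\in a))$, and Stratification (every set is a subset of some level). $\mathrm{pot}(a)=\{x:\exists c(x\subseteq c\in a)\}$ when it exists; $h$ is a history iff $x=\mathrm{pot}(x\cap h)$ for all $x\in h$; $s$ is a level iff $s=\mathrm{pot}(h)$ for some history $h$. In $\mathsf{LT}$ the levels are well-ordered by $\in$, and $\mathrm{lev}(a)$ denotes the $\in$-least level having $a$ as a subset, i.e. $a\subseteq\mathrm{lev}(a)$ and there is no level $s$ with $a\subseteq s\in\mathrm{lev}(a)$. -}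

module Defs where

open import Data.Product using (Σ; ∃; _×_; _,_)
open import Relation.Binary.PropositionalEquality using (_≡_)
open import Relation.Nullary using (¬_)
open import Function.Bundles using (_⇔_)

-- Definitions of Level Theory relative to a membership relation _∈_ on a
-- domain D.  "pot", "lev" are partial set operations, so they are expressed
-- as relations (IsPot p a : "p = pot(a)", IsLev l a : "l = lev(a)").
module LTDefs {D : Set} (_∈_ : D → D → Set) where

  _⊆_ : D → D → Set
  a ⊆ b = ∀ x → x ∈ a → x ∈ b

  IsPotOf : (D → Set) → D → Set
  IsPotOf P p = ∀ x → (x ∈ p) ⇔ (∃ λ c → (x ⊆ c) × P c)

  IsPot : D → D → Set
  IsPot a p = IsPotOf (λ c → c ∈ a) p

  History : D → Set
  History h = ∀ x → x ∈ h → IsPotOf (λ c → (c ∈ x) × (c ∈ h)) x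

  IsLevel : D → Set
  IsLevel s = ∃ λ h → History h × IsPot h s

  IsLev : D → D → Set
  IsLev a l = IsLevel l × (a ⊆ l) × ¬ (∃ λ s → IsLevel s × (a ⊆ s) × (s ∈ l))

record LT : Set₁ where
  field
    D   : Set
    _∈_ : D → D → Set
  open LTDefs _∈_ public
  field
    extensionality : ∀ a b → (∀ x → (x ∈ a) ⇔ (x ∈ b)) → a ≡ b
    separation     : (F : D → Set) → ∀ a → ∃ λ b → ∀ x → (x ∈ b) ⇔ (F x × (x ∈ a))
    stratification : ∀ a → ∃ λ s → IsLevel s × (a ⊆ s)

{-# OPTIONS --safe #-}
-- Excluded middle makes ∈ well-founded on every history h: if x ∈ h were not
-- accessible, then every accessible z below h lies in every inaccessible
-- member of h, so the accessible part R of x lies below an inaccessible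
-- e ∈ x ∩ h; as x = pot(x ∩ h) this gives R ∈ x and hence R ∈ R.  By
-- Stratification every set lies below some history, so ∈ is well-founded.
-- Levels are then transitive and ⊆-downward closed, ∈-induction makes any
-- two of them comparable, and each clause follows from the minimality of
-- lev(a): a member of lev(a) lies below a level that omits some x ∈ a.
module Submission where

open import Defs
open import Level using (0ℓ)
open import Axiom.ExcludedMiddle using (ExcludedMiddle)
open import Axiom.DoubleNegationElimination using (em⇒dne)
open import Data.Product using (∃; ∃₂; _×_; _,_; proj₁; proj₂)
open import Data.Sum using (_⊎_; inj₁; inj₂)
open import Data.Empty using (⊥-elim)
open import Induction.WellFounded using (Acc; acc; WellFounded; acc⇒asym; wf⇒asym)
open import Relation.Binary.PropositionalEquality using (_≡_; refl)
open import Relation.Nullary using (¬_; yes; no)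
open import Function.Bundles using (_⇔_; mk⇔; Equivalence)

module LevelTheory (M : LT) where
  open LT M
  open Equivalence using (to; from)

  ⊆-refl : ∀ {a} → a ⊆ a
  ⊆-refl _ x∈a = x∈a

  ⊆-trans : ∀ {a b c} → a ⊆ b → b ⊆ c → a ⊆ c
  ⊆-trans a⊆b b⊆c x x∈a = b⊆c x (a⊆b x x∈a)

  ⊆-antisym : ∀ {a b} → a ⊆ b → b ⊆ a → a ≡ b
  ⊆-antisym a⊆b b⊆a = extensionality _ _ λ x → mk⇔ (a⊆b x) (b⊆a x)

  Acc-⊆ : ∀ {a b} → a ⊆ b → Acc _∈_ b → Acc _∈_ a
  Acc-⊆ a⊆b (acc rs) = acc λ {x} x∈a → rs (a⊆b x x∈a)

  IsPotOf-cong : ∀ {P Q : D → Set} {p} →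
                 (∀ {c} → P c → Q c) → (∀ {c} → Q c → P c) → IsPotOf P p → IsPotOf Q p
  IsPotOf-cong P⇒Q Q⇒P pot x = mk⇔
    (λ x∈p → let c , x⊆c , Pc = to (pot x) x∈p in c , x⊆c , P⇒Q Pc)
    (λ { (c , x⊆c , Qc) → from (pot x) (c , x⊆c , Q⇒P Qc) })

  IsPotOf-downward-closed : ∀ {P p x c} → IsPotOf P p → x ⊆ c → c ∈ p → x ∈ p
  IsPotOf-downward-closed pot x⊆c c∈p =
    let d , c⊆d , Pd = to (pot _) c∈p in from (pot _) (d , ⊆-trans x⊆c c⊆d , Pd)

  level-downward-closed : ∀ {s x c} → IsLevel s → x ⊆ c → c ∈ s → x ∈ s
  level-downward-closed (_ , _ , s-pot) = IsPotOf-downward-closed s-pot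

  pot-exists : ∀ a → ∃ (IsPot a)
  pot-exists a with stratification a
  ... | s , ls , a⊆s = p , p-pot
    where
    sep = separation (λ x → ∃ λ c → x ⊆ c × c ∈ a) s
    p = proj₁ sep
    p-pot : IsPot a p
    p-pot x = mk⇔ (λ x∈p → proj₁ (to (proj₂ sep x) x∈p))
      λ { below@(c , x⊆c , c∈a) →
            from (proj₂ sep x) (below , level-downward-closed ls x⊆c (a⊆s c c∈a)) }

  pot⊆lev : ∀ {a p l} → IsPot a p → IsLev a l → p ⊆ l
  pot⊆lev p-pot (ll , a⊆l , _) x x∈p =
    let c , x⊆c , c∈a = to (p-pot x) x∈p in level-downward-closed ll x⊆c (a⊆l c c∈a)

  Comparable : D → D → Set
  Comparable r s = r ∈ s ⊎ r ≡ s ⊎ s ∈ r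

  Comparable-sym : ∀ {r s} → Comparable r s → Comparable s r
  Comparable-sym (inj₁ r∈s)         = inj₂ (inj₂ r∈s)
  Comparable-sym (inj₂ (inj₁ refl)) = inj₂ (inj₁ refl)
  Comparable-sym (inj₂ (inj₂ s∈r))  = inj₁ s∈r

  module Classical (em : ExcludedMiddle 0ℓ) where
    private
      dne = em⇒dne em

    ¬⊆⇒∃∉ : ∀ {a b} → ¬ a ⊆ b → ∃ λ x → x ∈ a × ¬ x ∈ b
    ¬⊆⇒∃∉ a⊈b = dne λ none → a⊈b λ x x∈a → dne λ x∉b → none (x , x∈a , x∉b)

    module _ {h} (hist : History h) where

      inaccessible-member : ∀ {x} → x ∈ h → ¬ Acc _∈_ x →
                            ∃ λ e → e ∈ x × e ∈ h × ¬ Acc _∈_ e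
      inaccessible-member {x} x∈h x↑ = dne λ none → x↑ (acc λ {y} y∈x →
        let d , y⊆d , d∈x , d∈h = to (hist x x∈h y) y∈x
        in Acc-⊆ y⊆d (dne λ d↑ → none (d , d∈x , d∈h , d↑)))

      accessible-∈-inaccessible : ∀ {z d e} → Acc _∈_ z → z ∈ d → d ∈ h →
                                  e ∈ h → ¬ Acc _∈_ e → z ∈ e
      accessible-∈-inaccessible {z} {d} {e} (acc rs) z∈d d∈h e∈h e↑ =
        let d′ , z⊆d′ , _ , d′∈h = to (hist d d∈h z) z∈d
            e′ , e′∈e , e′∈h , e′↑ = inaccessible-member e∈h e↑
            z⊆e′ : z ⊆ e′
            z⊆e′ w w∈z = accessible-∈-inaccessible (rs w∈z) (z⊆d′ w w∈z) d′∈h e′∈h e′↑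
        in from (hist e e∈h z) (e′ , z⊆e′ , e′∈e , e′∈h)

      history-accessible : ∀ {x} → x ∈ h → Acc _∈_ x
      history-accessible {x} x∈h = dne λ x↑ → no-inaccessible-member (inaccessible-member x∈h x↑)
        where
        sep = separation (Acc _∈_) x
        R = proj₁ sep
        R-acc : Acc _∈_ R
        R-acc = acc λ {z} z∈R → proj₁ (to (proj₂ sep z) z∈R)
        no-inaccessible-member : ¬ (∃ λ e → e ∈ x × e ∈ h × ¬ Acc _∈_ e)
        no-inaccessible-member (e , e∈x , e∈h , e↑) = acc⇒asym R-acc R∈R R∈R
          where
          R⊆e : R ⊆ e
          R⊆e z z∈R = let z-acc , z∈x = to (proj₂ sep z) z∈R
                      in accessible-∈-inaccessible z-acc z∈x x∈h e∈h e↑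
          R∈R = from (proj₂ sep R) (R-acc , from (hist x x∈h R) (e , R⊆e , e∈x , e∈h))

      history-transitive : ∀ {x y} → x ∈ h → y ∈ x → y ⊆ x
      history-transitive x∈h = go (history-accessible x∈h) x∈h
        where
        go : ∀ {x y} → Acc _∈_ x → x ∈ h → y ∈ x → y ⊆ x
        go {x} {y} (acc rs) x∈h y∈x z z∈y =
          let d , y⊆d , d∈x , d∈h = to (hist x x∈h y) y∈x
          in from (hist x x∈h z) (d , go (rs d∈x) d∈h (y⊆d z z∈y) , d∈x , d∈h)

      history-member-isLevel : ∀ {c} → c ∈ h → IsLevel c
      history-member-isLevel {c} c∈h = hc , hc-history , c-pot
        where
        sep = separation (λ y → y ∈ h) c
        hc = proj₁ sep
        ∈hc⇒∈h : ∀ {y} → y ∈ hc → y ∈ h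
        ∈hc⇒∈h {y} y∈hc = proj₁ (to (proj₂ sep y) y∈hc)
        hc-history : History hc
        hc-history y y∈hc = IsPotOf-cong
          (λ { (d∈y , d∈h) → d∈y , from (proj₂ sep _)
                 (d∈h , history-transitive c∈h (proj₂ (to (proj₂ sep y) y∈hc)) _ d∈y) })
          (λ { (d∈y , d∈hc) → d∈y , ∈hc⇒∈h d∈hc })
          (hist y (∈hc⇒∈h y∈hc))
        c-pot : IsPot hc c
        c-pot = IsPotOf-cong
          (λ { (d∈c , d∈h) → from (proj₂ sep _) (d∈h , d∈c) })
          (λ d∈hc → let d∈h , d∈c = to (proj₂ sep _) d∈hc in d∈c , d∈h)
          (hist c c∈h)

    ∈-wellFounded : WellFounded _∈_
    ∈-wellFounded a with stratification a
    ... | s , (h , hist , s-pot) , a⊆s = acc λ {y} y∈a →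
      let c , y⊆c , c∈h = to (s-pot y) (a⊆s y y∈a)
      in Acc-⊆ y⊆c (history-accessible hist c∈h)

    ∈-irrefl : ∀ {a} → ¬ a ∈ a
    ∈-irrefl a∈a = wf⇒asym ∈-wellFounded a∈a a∈a

    level-transitive : ∀ {s y} → IsLevel s → y ∈ s → y ⊆ s
    level-transitive (h , hist , s-pot) y∈s z z∈y =
      let c , y⊆c , c∈h = to (s-pot _) y∈s
      in from (s-pot z) (c , history-transitive hist c∈h (y⊆c z z∈y) , c∈h)

    level-member-covered : ∀ {s x} → IsLevel s → x ∈ s →
                           ∃ λ t → IsLevel t × t ∈ s × x ⊆ t
    level-member-covered (h , hist , s-pot) x∈s =
      let c , x⊆c , c∈h = to (s-pot _) x∈s
      in c , history-member-isLevel hist c∈h , from (s-pot c) (c , ⊆-refl , c∈h) , x⊆c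

    members-comparable⇒⊆ : ∀ {r s} → IsLevel r → IsLevel s → ¬ s ∈ r →
                           (∀ {t} → IsLevel t → t ∈ r → Comparable t s) → r ⊆ s
    members-comparable⇒⊆ lr ls s∉r comparable x x∈r
      with level-member-covered lr x∈r
    ... | t , lt , t∈r , x⊆t with comparable lt t∈r
    ... | inj₁ t∈s         = level-downward-closed ls x⊆t t∈s
    ... | inj₂ (inj₁ refl) = ⊥-elim (s∉r t∈r)
    ... | inj₂ (inj₂ s∈t)  = ⊥-elim (s∉r (level-transitive lr t∈r _ s∈t))

    levels-comparable : ∀ {r s} → IsLevel r → IsLevel s → Comparable r s
    levels-comparable = go (∈-wellFounded _) (∈-wellFounded _)
      where
      go : ∀ {r s} → Acc _∈_ r → Acc _∈_ s → IsLevel r → IsLevel s → Comparable r s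
      go {r} {s} r-acc@(acc rs) s-acc@(acc ss) lr ls with em {r ∈ s} | em {s ∈ r}
      ... | yes r∈s | _       = inj₁ r∈s
      ... | no _    | yes s∈r = inj₂ (inj₂ s∈r)
      ... | no r∉s  | no s∉r  = inj₂ (inj₁ (⊆-antisym
        (members-comparable⇒⊆ lr ls s∉r λ lt t∈r → go (rs t∈r) s-acc lt ls)
        (members-comparable⇒⊆ ls lr r∉s λ lt t∈s →
          Comparable-sym (go r-acc (ss t∈s) lr lt))))

    level-⊆⇔∉ : ∀ {r s} → IsLevel r → IsLevel s → r ⊆ s ⇔ (¬ s ∈ r)
    level-⊆⇔∉ lr ls = mk⇔ (λ r⊆s s∈r → ∈-irrefl (r⊆s _ s∈r))
      λ s∉r → members-comparable⇒⊆ lr ls s∉r λ lt _ → levels-comparable lt ls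

    lev-exists : ∀ a → ∃ (IsLev a)
    lev-exists a with stratification a
    ... | s , ls , a⊆s = descend (∈-wellFounded s) ls a⊆s
      where
      descend : ∀ {s} → Acc _∈_ s → IsLevel s → a ⊆ s → ∃ (IsLev a)
      descend {s} (acc rs) ls a⊆s with em {∃ λ t → IsLevel t × a ⊆ t × t ∈ s}
      ... | yes (t , lt , a⊆t , t∈s) = descend (rs t∈s) lt a⊆t
      ... | no none                   = s , ls , a⊆s , none

    lev-⊆-level : ∀ {a l t} → IsLev a l → IsLevel t → a ⊆ t → l ⊆ t
    lev-⊆-level (ll , _ , minimal) lt a⊆t =
      from (level-⊆⇔∉ ll lt) λ t∈l → minimal (_ , lt , a⊆t , t∈l)

    ∉-lev : ∀ {a l} → IsLev a l → ¬ a ∈ l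
    ∉-lev (ll , _ , minimal) a∈l =
      let t , lt , t∈l , a⊆t = level-member-covered ll a∈l
      in minimal (t , lt , a⊆t , t∈l)

    level-isLev-self : ∀ {s} → IsLevel s → IsLev s s
    level-isLev-self ls = ls , ⊆-refl , λ { (t , _ , s⊆t , t∈s) → ∈-irrefl (s⊆t t t∈s) }

    lev-mono-⊆ : ∀ {a b la lb} → IsLev a la → IsLev b lb → b ⊆ a → lb ⊆ la
    lev-mono-⊆ (lla , a⊆la , _) b-lev b⊆a = lev-⊆-level b-lev lla (⊆-trans b⊆a a⊆la)

    lev-mono-∈ : ∀ {a b la lb} → IsLev a la → IsLev b lb → b ∈ a → lb ∈ la
    lev-mono-∈ (lla , a⊆la , _) b-lev b∈a =
      let t , lt , t∈la , b⊆t = level-member-covered lla (a⊆la _ b∈a)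
      in level-downward-closed lla (lev-⊆-level b-lev lt b⊆t) t∈la

    lev-member-below-omitting-level : ∀ {a l z} → IsLev a l → z ∈ l →
      ∃₂ λ t x → IsLevel t × z ⊆ t × x ∈ a × ¬ x ∈ t
    lev-member-below-omitting-level (ll , _ , minimal) z∈l =
      let t , lt , t∈l , z⊆t = level-member-covered ll z∈l
          x , x∈a , x∉t = ¬⊆⇒∃∉ λ a⊆t → minimal (t , lt , a⊆t , t∈l)
      in t , x , lt , z⊆t , x∈a , x∉t

    lev-pot-of-levs : ∀ {a l} → IsLev a l →
      ∃ λ c → (∀ y → (y ∈ c) ⇔ (∃ λ x → (x ∈ a) × IsLev x y)) × IsPot c l
    lev-pot-of-levs {a} {l} a-lev@(ll , _ , _) = c , c-def , c-pot
      where
      sep = separation (λ y → ∃ λ x → x ∈ a × IsLev x y) l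
      c = proj₁ sep
      c-def : ∀ y → (y ∈ c) ⇔ (∃ λ x → x ∈ a × IsLev x y)
      c-def y = mk⇔ (λ y∈c → proj₁ (to (proj₂ sep y) y∈c))
        λ { levs@(x , x∈a , x-lev) → from (proj₂ sep y) (levs , lev-mono-∈ a-lev x-lev x∈a) }
      c-pot : IsPot c l
      c-pot z = mk⇔
        (λ z∈l →
          let t , x , lt , z⊆t , x∈a , x∉t = lev-member-below-omitting-level a-lev z∈l
              y , x-lev@(ly , x⊆y , _) = lev-exists x
              t⊆y = from (level-⊆⇔∉ lt ly) λ y∈t → x∉t (level-downward-closed lt x⊆y y∈t)
          in y , ⊆-trans z⊆t t⊆y , from (c-def y) (x , x∈a , x-lev))
        λ { (d , z⊆d , d∈c) → level-downward-closed ll z⊆d (proj₂ (to (proj₂ sep d) d∈c)) }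

    pot≡lev-of-levels : ∀ {a p l} → (∀ x → x ∈ a → IsLevel x) → IsPot a p → IsLev a l → p ≡ l
    pot≡lev-of-levels levels p-pot a-lev = ⊆-antisym (pot⊆lev p-pot a-lev) λ z z∈l →
      let t , x , lt , z⊆t , x∈a , x∉t = lev-member-below-omitting-level a-lev z∈l
          t⊆x = from (level-⊆⇔∉ lt (levels x x∈a)) x∉t
      in from (p-pot z) (x , ⊆-trans z⊆t t⊆x , x∈a)

lemma14 : ExcludedMiddle 0ℓ → (M : LT) → let open LT M in
    -- (1) lev(a) and pot(a) exist, and pot(a) ⊆ lev(a)
    ((∀ a → (∃ λ l → IsLev a l) × (∃ λ p → IsPot a p))
      × (∀ a p l → IsPot a p → IsLev a l → p ⊆ l))
    -- (2) a ∉ lev(a)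
  × (∀ a l → IsLev a l → ¬ (a ∈ l))
    -- (3) for levels r, s : r ⊆ s iff s ∉ r
  × (∀ r s → IsLevel r → IsLevel s → (r ⊆ s) ⇔ (¬ (s ∈ r)))
    -- (4) s = lev(s) for levels s
  × (∀ s → IsLevel s → IsLev s s)
    -- (5) b ⊆ a → lev(b) ⊆ lev(a)
  × (∀ a b la lb → IsLev a la → IsLev b lb → b ⊆ a → lb ⊆ la)
    -- (6) b ∈ a → lev(b) ∈ lev(a)
  × (∀ a b la lb → IsLev a la → IsLev b lb → b ∈ a → lb ∈ la)
    -- (7) lev(a) = pot({lev(x) : x ∈ a}) (that set exists)
  × (∀ a l → IsLev a l →
      ∃ λ c → (∀ y → (y ∈ c) ⇔ (∃ λ x → (x ∈ a) × IsLev x y)) × IsPot c l)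
    -- (8) if every member of a is a level, pot(a) = lev(a)
  × (∀ a p l → (∀ x → x ∈ a → IsLevel x) → IsPot a p → IsLev a l → p ≡ l)
lemma14 em M =
    ((λ a → lev-exists a , pot-exists a) , λ _ _ _ → pot⊆lev)
  , (λ _ _ → ∉-lev)
  , (λ _ _ → level-⊆⇔∉)
  , (λ _ → level-isLev-self)
  , (λ _ _ _ _ → lev-mono-⊆)
  , (λ _ _ _ _ → lev-mono-∈)
  , (λ _ _ → lev-pot-of-levs)
  , (λ _ _ _ → pot≡lev-of-levels)
  where
  open LevelTheory M
  open Classical em
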